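{- Let $\mathcal{A}=(Q,\delta,I,Q_F\cup\delta_F)$ be a Büchi automaton, let $\mu\colon 2^Q\to\omega$ be a tight rank upper bound (TRUB) of $\mathcal{A}$, let $S\subseteq Q$, and let $R_1,\dots,R_m$ be the distinct sets $R\subseteq Q$ such that $\delta(R,a)=S$ for some $a\in\Sigma$. Define $\mathrm{upd}_{out}(\mu,S,R_1,\dots,R_m)=\min\{\mu(S),\max\{\mu(R_1),\dots,\mu(R_m)\}\}$ (with $\max\emptyset=0$). Then the map $\mu'\colon 2^Q\to\omega$ with $\mu'(S)=\mathrm{upd}_{out}(\mu,S,R_1,\dots,R_m)$ and $\mu'(P)=\mu(P)$ for $P\ne S$ is a TRUB of $\mathcal{A}$.
   Context: BAs: $\mathcal{A}=(Q,\delta,I,Q_F\cup\delta_F)$ over a finite alphabet $\Sigma$ with finite $Q$, $\delta\colon Q\times\Sigma\to2^Q$, initial states $I$, accepting states $Q_F$, accepting transitions $\delta_F\subseteq\delta$; $\delta(R,a)=\bigcup_{r\in R}\delta(r,a)$. Runs on $\alpha=\alpha_0\alpha_1\cdots$: $\rho_{i+1}\in\delta(\rho_i,\alpha_i)$; accepting iff a state in $Q_F$ or a transition in $\delta_F$ occurs infinitely often; $\mathcal{L}(\mathcal{A})$: words with an accepting run from an initial state. $n=|Q|$. $x\mathbin{\dot- }y=\max\{x-y,0\}$. Run DAG: $\mathcal{G}_\alpha$ has vertices $(q,i)$ such that some run from an initial state over $\alpha$ has $\rho_i=q$, edges $((q,i),(q',i+1))$ for $q'\in\delta(q,\alpha_i)$;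 vertex $(p,i)$ accepting if $p\in Q_F$, edge accepting if it corresponds to a transition of $\delta_F$; finite vertex: finitely many vertices reachable; endangered: no accepting vertex or edge reachable. With $\mathcal{G}^0=\mathcal{G}_\alpha$, $j=0$, repeat until fixpoint or at most $2n+1$ times: rank $j$ to finite vertices of $\mathcal{G}^j$, remove them ($\mathcal{G}^{j+1}$); rank $j+1$ to endangered vertices of $\mathcal{G}^{j+1}$, remove them ($\mathcal{G}^{j+2}$); $j\gets j+2$; others rank $\omega$. $\mathrm{level}_\alpha(\ell)=\{q\mid(q,\ell)\in\mathcal{G}_\alpha\}$; $f^\alpha_\ell(q)$ is the rank of $(q,\ell)$ if $q\in\mathrm{level}_\alpha(\ell)$, else $0$. For $f\colon Q\to\omega$, $\mathrm{rank}(f)=\max_qf(q)$; $f$ is tight if $r=\mathrm{rank}(f)$ is odd and $f(Q)\supseteq\{1,3,\dots,r\}$. Level $\ell$ is tight if for all $k\ge\ell$, $f^\alpha_k$ is tight and $\mathrm{rank}(f^\alpha_k)=\mathrm{rank}(f^\alpha_\ell)$. A map $\nu$ from $2^Q$ to functions $Q\to\omega$ is a TRUB iff for every $\alpha\in\Sigma^\omega\setminus\mathcal{L}(\mathcal{A})$ there is a tight level $\ell$ with $\nu(\mathrm{level}_\alpha(k))\ge f^\alpha_k$ pointwise for all $k\ge\ell$. A map $\mu\colon2^Q\to\omega$ is a TRUB iff $\inf(\mu)$ is, where $\inf(\mu)(S)(q)=\mu(S)\mathbin{\dot- }1$ if $q\in Q_F$ and $\inf(\mu)(S)(q)=\mu(S)$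 otherwise. -}

module Defs where

open import Data.Nat using (ℕ; zero; suc; _+_; _*_; _∸_; _≤_; _<_; _≥_; _⊔_; _⊓_)
open import Data.Bool using (Bool; true; false; _∧_; _∨_; if_then_else_; not)
open import Data.Bool.Properties using () renaming (_≟_ to _≟B_)
open import Data.Fin using (Fin)
open import Data.Fin.Subset using (Subset; _∈_)
open import Data.Vec using (Vec; []; _∷_; lookup; tabulate)
import Data.Vec as Vec
open import Data.Vec.Properties using (≡-dec)
open import Data.List using (List; []; _∷_; _++_; map; allFin; filter; foldr)
open import Data.Bool.ListAction using (any)
open import Data.List.Membership.Propositional using () renaming (_∈_ to _∈L_)
open import Data.Product using (Σ; ∃; ∃-syntax; _×_; _,_)
open import Data.Sum using (_⊎_)
open import Relation.Nullary using (¬_; does; Dec)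
open import Relation.Binary.PropositionalEquality using (_≡_)

record BA (n s : ℕ) : Set where
  field
    δ    : Fin n → Fin s → Subset n
    I    : Subset n
    QF   : Subset n
    δF   : Fin n → Fin s → Subset n
    δF⊆δ : ∀ q a q' → q' ∈ δF q a → q' ∈ δ q a

anyFin : ∀ {n} → (Fin n → Bool) → Bool
anyFin {n} p = Vec.foldr _ _∨_ false (tabulate p)

allSubsets : ∀ n → List (Subset n)
allSubsets zero    = [] ∷ []
allSubsets (suc n) = map (true ∷_) (allSubsets n) ++ map (false ∷_) (allSubsets n)

module _ {n s : ℕ} (A : BA n s) where
  open BA A

  δset : Subset n → Fin s → Subset n
  δset R a = tabulate (λ q → anyFin (λ r → lookup R r ∧ lookup (δ r a) q))

  Word : Set
  Word = ℕ → Fin s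

  Accepted : Word → Set
  Accepted α = Σ (ℕ → Fin n) λ ρ → (ρ 0 ∈ I × (∀ i → ρ (suc i) ∈ δ (ρ i) (α i))
                 × (∀ N → ∃[ i ] (N ≤ i × (ρ i ∈ QF ⊎ ρ (suc i) ∈ δF (ρ i) (α i)))))

  Vertex : Set
  Vertex = Fin n × ℕ

  module _ (α : Word) where
    InDAG : Vertex → Set
    InDAG (q , i) = Σ (ℕ → Fin n) λ ρ → (ρ 0 ∈ I × (∀ k → k < i → ρ (suc k) ∈ δ (ρ k) (α k)) × ρ i ≡ q)

    IsLevel : ℕ → Subset n → Set
    IsLevel ℓ S = ∀ q → (q ∈ S → InDAG (q , ℓ)) × (InDAG (q , ℓ) → q ∈ S)

    data Reach (G : Vertex → Set) (v : Vertex) : Vertex → Set where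
      here : G v → Reach G v v
      step : ∀ {q i q'} → Reach G v (q , i) → G (q' , suc i) → q' ∈ δ q (α i)
           → Reach G v (q' , suc i)

    FiniteV : (Vertex → Set) → Vertex → Set
    FiniteV G v = ∃[ L ] (∀ w → Reach G v w → w ∈L L)

    Endangered : (Vertex → Set) → Vertex → Set
    Endangered G v =
        (∀ q i → Reach G v (q , i) → ¬ (q ∈ QF))
      × (∀ q i q' → Reach G v (q , i) → G (q' , suc i) → q' ∈ δ q (α i)
           → ¬ (q' ∈ δF q (α i)))

    isEven : ℕ → Bool
    isEven zero          = true
    isEven (suc zero)    = false
    isEven (suc (suc k)) = isEven k

    Gj : ℕ → Vertex → Set
    Gj zero v    = InDAG v
    Gj (suc j) v = Gj j v × ¬ (if isEven j then FiniteV (Gj j) v else Endangered (Gj j) v)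

    -- largest finite rank: 2n+1 iterations give ranks 0,…,4n+1; the rest rank ω
    maxRank : ℕ
    maxRank = 4 * n + 1

    -- FVal ℓ q j : f^α_ℓ(q) = j  (j a natural number; rank ω is never a value)
    FVal : ℕ → Fin n → ℕ → Set
    FVal ℓ q j = (¬ InDAG (q , ℓ) × j ≡ 0)
               ⊎ (InDAG (q , ℓ) × j ≤ maxRank × Gj j (q , ℓ) × ¬ Gj (suc j) (q , ℓ))

    Odd : ℕ → Set
    Odd r = isEven r ≡ false

    TightWithRank : ℕ → ℕ → Set
    TightWithRank k r =
        Odd r
      × (∀ q → ∃[ j ] FVal k q j)
      × (∀ q j → FVal k q j → j ≤ r)
      × (∀ o → Odd o → o ≤ r → ∃[ q ] FVal k q o)

    TightLevel : ℕ → Set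
    TightLevel ℓ = ∃[ r ] (∀ k → ℓ ≤ k → TightWithRank k r)

  TRUB : (Subset n → Fin n → ℕ) → Set
  TRUB ν = ∀ (α : Word) → ¬ Accepted α →
    ∃[ ℓ ] (TightLevel α ℓ ×
      (∀ k → ℓ ≤ k → ∀ S → IsLevel α k S → ∀ q j → FVal α k q j → j ≤ ν S q))

  infμ : (Subset n → ℕ) → Subset n → Fin n → ℕ
  infμ μ S q = if lookup QF q then μ S ∸ 1 else μ S

  TRUBμ : (Subset n → ℕ) → Set
  TRUBμ μ = TRUB (infμ μ)

  _≟S_ : (R S : Subset n) → Dec (R ≡ S)
  R ≟S S = ≡-dec _≟B_ R S

  isPred : Subset n → Subset n → Bool
  isPred S R = any (λ a → does (δset R a ≟S S)) (allFin s)

  maxPred : (Subset n → ℕ) → Subset n → ℕ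
  maxPred μ S = foldr (λ R m → (if isPred S R then μ R else 0) ⊔ m) 0 (allSubsets n)

  updOut : (Subset n → ℕ) → Subset n → ℕ
  updOut μ S = μ S ⊓ maxPred μ S

  μ' : (Subset n → ℕ) → Subset n → Subset n → ℕ
  μ' μ S P = if does (P ≟S S) then updOut μ S else μ P

-- If the tight level ℓ of rank r witnesses that μ is a TRUB for α ∉ L(A), then ℓ + 1 witnesses it
-- for μ′, and only levels S = level_α(k + 1) with k ≥ ℓ need an argument. Their predecessor
-- R = level_α(k) satisfies δ(R, α_k) = S, and as the odd rank r is attained on level k,
-- r ≤ μ(R) ≤ max_i μ(R_i). The ranks on level k + 1 are at most r, and below r at accepting
-- states because odd ranks go to endangered vertices; so inf(max_i μ(R_i)) bounds them as well.
module Submission where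

open import Defs
open import Data.Nat using (ℕ; zero; suc; _≤_; _<_; _⊔_; _⊓_; z≤n; s≤s)
open import Data.Nat.Properties
  using (≤-refl; ≤-trans; n≤1+n; <⇒≤; ≤∧≢⇒<; m≤n⇒m<n∨m≡n; m∸n≤m; ∸-monoˡ-≤;
         ∸-distribʳ-⊓; m⊓n≤m; ⊓-glb; m≤m⊔n; m≤n⊔m; module ≤-Reasoning)
open import Data.Bool using (Bool; true; false; T; _∧_; if_then_else_)
open import Data.Bool.Properties using (T-≡; T-∨; T-∧)
open import Data.Fin using (Fin)
import Data.Fin as Fin
open import Data.Fin.Subset using (Subset; _∈_; _∉_)
open import Data.Fin.Subset.Properties using (⊆-antisym)
open import Data.Vec using ([]; _∷_; lookup; tabulate)
open import Data.Vec.Properties using (lookup∘tabulate; []=⇒lookup; lookup⇒[]=)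
open import Data.List using (List; _∷_; map; foldr)
open import Data.List.Membership.Propositional using (lose) renaming (_∈_ to _∈L_)
open import Data.List.Membership.Propositional.Properties using (∈-allFin; ∈-++⁺ˡ; ∈-++⁺ʳ; ∈-map⁺)
open import Data.List.Relation.Unary.Any using (here; there)
open import Data.List.Relation.Unary.Any.Properties using (any⁺)
open import Data.Product using (∃; ∃-syntax; _×_; _,_; proj₁; proj₂)
open import Data.Sum using (inj₁; inj₂; [_,_])
open import Function.Bundles using (Equivalence)
open import Relation.Nullary using (Dec; yes; no; does)
open import Relation.Nullary.Decidable using (isYes; fromWitness; toWitness; dec-true)
open import Relation.Binary.PropositionalEquality
  using (_≡_; _≢_; refl; sym; subst)

open Equivalence using (to; from)

∈⇒T-lookup : ∀ {m} {q : Fin m} {P : Subset m} → q ∈ P → T (lookup P q)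
∈⇒T-lookup q∈P = from T-≡ ([]=⇒lookup q∈P)

T-lookup⇒∈ : ∀ {m} {q : Fin m} {P : Subset m} → T (lookup P q) → q ∈ P
T-lookup⇒∈ {q = q} {P} t = lookup⇒[]= q P (to T-≡ t)

∈-tabulate⁺ : ∀ {m} (f : Fin m → Bool) {q : Fin m} → T (f q) → q ∈ tabulate f
∈-tabulate⁺ f {q} t = T-lookup⇒∈ (subst T (sym (lookup∘tabulate f q)) t)

∈-tabulate⁻ : ∀ {m} (f : Fin m → Bool) {q : Fin m} → q ∈ tabulate f → T (f q)
∈-tabulate⁻ f {q} q∈ = subst T (lookup∘tabulate f q) (∈⇒T-lookup q∈)

anyFin⁺ : ∀ {m} (p : Fin m → Bool) {r : Fin m} → T (p r) → T (anyFin p)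
anyFin⁺ p {Fin.zero}  t = from T-∨ (inj₁ t)
anyFin⁺ p {Fin.suc r} t = from T-∨ (inj₂ (anyFin⁺ (λ i → p (Fin.suc i)) t))

anyFin⁻ : ∀ {m} (p : Fin m → Bool) → T (anyFin p) → ∃[ r ] T (p r)
anyFin⁻ {suc m} p t =
  [ (λ t₀ → Fin.zero , t₀)
  , (λ t₁ → let r , tr = anyFin⁻ (λ i → p (Fin.suc i)) t₁ in Fin.suc r , tr)
  ] (to T-∨ t)

∈-allSubsets : ∀ n (R : Subset n) → R ∈L allSubsets n
∈-allSubsets zero    []          = here refl
∈-allSubsets (suc n) (true ∷ R)  = ∈-++⁺ˡ (∈-map⁺ (true ∷_) (∈-allSubsets n R))
∈-allSubsets (suc n) (false ∷ R) =
  ∈-++⁺ʳ (map (true ∷_) (allSubsets n)) (∈-map⁺ (false ∷_) (∈-allSubsets n R))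

≤-foldr-⊔-if : ∀ {X : Set} (p : X → Bool) (f : X → ℕ) {x : X} (xs : List X) →
               x ∈L xs → T (p x) → f x ≤ foldr (λ y m → (if p y then f y else 0) ⊔ m) 0 xs
≤-foldr-⊔-if p f {x} (x ∷ xs) (here refl) t with p x
... | true = m≤m⊔n (f x) _
≤-foldr-⊔-if p f (y ∷ xs) (there x∈xs) t =
  ≤-trans (≤-foldr-⊔-if p f xs x∈xs t) (m≤n⊔m (if p y then f y else 0) _)

if-false : ∀ {X Y : Set} {b} → b ≡ false → (if b then X else Y) → Y
if-false refl y = y

-- The run that follows ρ up to position m and then stays in q.
cutAt : ∀ {X : Set} → (ℕ → X) → ℕ → X → ℕ → X
cutAt ρ zero    q zero    = ρ zero
cutAt ρ zero    q (suc i) = q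
cutAt ρ (suc m) q zero    = ρ zero
cutAt ρ (suc m) q (suc i) = cutAt (λ i → ρ (suc i)) m q i

cutAt-≤ : ∀ {X : Set} (ρ : ℕ → X) {m} q {i} → i ≤ m → cutAt ρ m q i ≡ ρ i
cutAt-≤ ρ {zero}  q z≤n       = refl
cutAt-≤ ρ {suc m} q z≤n       = refl
cutAt-≤ ρ {suc m} q (s≤s i≤m) = cutAt-≤ (λ i → ρ (suc i)) q i≤m

cutAt-suc : ∀ {X : Set} (ρ : ℕ → X) m q → cutAt ρ m q (suc m) ≡ q
cutAt-suc ρ zero    q = refl
cutAt-suc ρ (suc m) q = cutAt-suc (λ i → ρ (suc i)) m q

module _ {n s : ℕ} (A : BA n s) where
  open BA A

  ∈-δset⁺ : ∀ {R r q a} → r ∈ R → q ∈ δ r a → q ∈ δset A R a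
  ∈-δset⁺ {R} {r} {q} {a} r∈R q∈δ =
    ∈-tabulate⁺ _ (anyFin⁺ (λ r → lookup R r ∧ lookup (δ r a) q) {r}
                           (from T-∧ (∈⇒T-lookup r∈R , ∈⇒T-lookup q∈δ)))

  ∈-δset⁻ : ∀ {R q a} → q ∈ δset A R a → ∃[ r ] (r ∈ R × q ∈ δ r a)
  ∈-δset⁻ {R} {q} {a} q∈ =
    let r , t = anyFin⁻ (λ r → lookup R r ∧ lookup (δ r a) q) (∈-tabulate⁻ _ q∈)
        tR , tδ = to T-∧ t
    in r , T-lookup⇒∈ tR , T-lookup⇒∈ tδ

  isPred⁺ : ∀ {R S a} → δset A R a ≡ S → T (isPred A S R)
  isPred⁺ {R} {S} {a} eq =
    any⁺ (λ b → does (_≟S_ A (δset A R b) S))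
         (lose (∈-allFin a) (from T-≡ (dec-true (_≟S_ A (δset A R a) S) eq)))

  μ≤maxPred : ∀ μ {R S} → T (isPred A S R) → μ R ≤ maxPred A μ S
  μ≤maxPred μ {R} {S} = ≤-foldr-⊔-if (isPred A S) μ (allSubsets n) (∈-allSubsets n R)

  infμ-≤ : ∀ μ P q → infμ A μ P q ≤ μ P
  infμ-≤ μ P q with lookup QF q
  ... | true  = m∸n≤m (μ P) 1
  ... | false = ≤-refl

  infμ-mono : ∀ μ ν P q → μ P ≤ ν P → infμ A μ P q ≤ infμ A ν P q
  infμ-mono μ ν P q μ≤ν with lookup QF q
  ... | true  = ∸-monoˡ-≤ 1 μ≤ν
  ... | false = μ≤ν

  infμ-⊓ : ∀ μ ν P q → infμ A (λ P → μ P ⊓ ν P) P q ≡ infμ A μ P q ⊓ infμ A ν P q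
  infμ-⊓ μ ν P q with lookup QF q
  ... | true  = ∸-distribʳ-⊓ 1 (μ P) (ν P)
  ... | false = refl

  ≤-infμ : ∀ {j} ν P q → j ≤ ν P → (q ∈ QF → j < ν P) → j ≤ infμ A ν P q
  ≤-infμ ν P q j≤ j< with lookup QF q in eq
  ... | true  = ∸-monoˡ-≤ 1 (j< (lookup⇒[]= q QF eq))
  ... | false = j≤

  ⊓-maxPred≤μ′ : ∀ μ S P → μ P ⊓ maxPred A μ P ≤ μ' A μ S P
  ⊓-maxPred≤μ′ μ S P with _≟S_ A P S
  ... | yes refl = ≤-refl
  ... | no _     = m⊓n≤m (μ P) (maxPred A μ P)

  ≤-infμ-μ′ : ∀ {j} μ S P q → j ≤ infμ A μ P q → j ≤ infμ A (maxPred A μ) P q →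
              j ≤ infμ A (μ' A μ S) P q
  ≤-infμ-μ′ {j} μ S P q j≤μ j≤maxPred = begin
    j                                              ≤⟨ ⊓-glb j≤μ j≤maxPred ⟩
    infμ A μ P q ⊓ infμ A (maxPred A μ) P q        ≡⟨ infμ-⊓ μ (maxPred A μ) P q ⟨
    infμ A μ⊓maxPred P q                           ≤⟨ infμ-mono μ⊓maxPred (μ' A μ S) P q (⊓-maxPred≤μ′ μ S P) ⟩
    infμ A (μ' A μ S) P q                          ∎
    where
    open ≤-Reasoning
    μ⊓maxPred : Subset n → ℕ
    μ⊓maxPred P = μ P ⊓ maxPred A μ P

  module _ (α : Word A) where

    InDAG-step : ∀ {r q m} → InDAG A α (r , m) → q ∈ δ r (α m) → InDAG A α (q , suc m)
    InDAG-step {q = q} {m} (ρ , ρ₀∈I , steps , ρₘ≡r) q∈δ =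
      cutAt ρ m q , subst (_∈ I) (sym (cutAt-≤ ρ {m} q z≤n)) ρ₀∈I , steps′ , cutAt-suc ρ m q
      where
      steps′ : ∀ k → k < suc m → cutAt ρ m q (suc k) ∈ δ (cutAt ρ m q k) (α k)
      steps′ k (s≤s k≤m) with m≤n⇒m<n∨m≡n k≤m
      ... | inj₁ k<m rewrite cutAt-≤ ρ q k<m | cutAt-≤ ρ q k≤m = steps k k<m
      ... | inj₂ refl rewrite cutAt-suc ρ k q | cutAt-≤ ρ q k≤m | ρₘ≡r = q∈δ

    InDAG-pred : ∀ {q m} → InDAG A α (q , suc m) → ∃[ r ] (InDAG A α (r , m) × q ∈ δ r (α m))
    InDAG-pred {m = m} (ρ , ρ₀∈I , steps , ρₘ₊₁≡q) =
      ρ m , (ρ , ρ₀∈I , (λ k k<m → steps k (≤-trans k<m (n≤1+n m))) , refl)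
          , subst (_∈ δ (ρ m) (α m)) ρₘ₊₁≡q (steps m ≤-refl)

    δset-level : ∀ {m R P} → IsLevel A α m R → IsLevel A α (suc m) P → δset A R (α m) ≡ P
    δset-level {m} {R} {P} R-lev P-lev = ⊆-antisym δR⊆P P⊆δR
      where
      δR⊆P : ∀ {q} → q ∈ δset A R (α m) → q ∈ P
      δR⊆P {q} q∈ =
        let r , r∈R , q∈δ = ∈-δset⁻ q∈
        in proj₂ (P-lev q) (InDAG-step (proj₁ (R-lev r) r∈R) q∈δ)
      P⊆δR : ∀ {q} → q ∈ P → q ∈ δset A R (α m)
      P⊆δR {q} q∈P =
        let r , r∈G , q∈δ = InDAG-pred (proj₁ (P-lev q) q∈P)
        in ∈-δset⁺ (proj₂ (R-lev r) r∈G) q∈δ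

    decidable⇒level : ∀ {k} → (∀ q → Dec (InDAG A α (q , k))) → ∃ (IsLevel A α k)
    decidable⇒level dec =
      tabulate (λ q → isYes (dec q)) ,
      λ q → (λ q∈ → toWitness (∈-tabulate⁻ _ q∈)) , (λ v → ∈-tabulate⁺ _ (fromWitness v))

    -- Tightness gives every state a finite rank, which decides whether (q, k) is a vertex,
    -- so the level set exists constructively.
    tight⇒level : ∀ {k r} → TightWithRank A α k r → ∃ (IsLevel A α k)
    tight⇒level (_ , ranked , _) = decidable⇒level λ q → decide (proj₂ (ranked q))
      where
      decide : ∀ {q k j} → FVal A α k q j → Dec (InDAG A α (q , k))
      decide (inj₁ (∉G , _)) = no ∉G
      decide (inj₂ (∈G , _)) = yes ∈G

    -- A vertex of odd rank r was removed from G^r as endangered, yet it reaches itself.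
    odd-rank⇒∉QF : ∀ {k q r} → Odd A α r → FVal A α k q r → q ∉ QF
    odd-rank⇒∉QF odd (inj₁ (_ , refl)) with odd
    ... | ()
    odd-rank⇒∉QF {k} {q} odd (inj₂ (_ , _ , v∈Gʳ , v∉Gʳ⁺¹)) q∈QF =
      v∉Gʳ⁺¹ (v∈Gʳ , λ removed → proj₁ (if-false odd removed) q k (here v∈Gʳ) q∈QF)

    tight-rank≤μ : ∀ {k r} μ R → TightWithRank A α k r →
                   (∀ q j → FVal A α k q j → j ≤ infμ A μ R q) → r ≤ μ R
    tight-rank≤μ μ R (odd , _ , _ , attained) bounded =
      let q , fv = attained _ odd ≤-refl
      in ≤-trans (bounded q _ fv) (infμ-≤ μ R q)

    tight-≤-infμ : ∀ {k r q j} ν P → TightWithRank A α k r → r ≤ ν P → FVal A α k q j →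
                   j ≤ infμ A ν P q
    tight-≤-infμ {r = r} {q} {j} ν P (odd , _ , ≤rank , _) r≤ν fv =
      ≤-infμ ν P q (≤-trans j≤r r≤ν) λ q∈QF → ≤-trans (≤∧≢⇒< j≤r (j≢r q∈QF)) r≤ν
      where
      j≤r : j ≤ r
      j≤r = ≤rank q j fv
      j≢r : q ∈ QF → j ≢ r
      j≢r q∈QF refl = odd-rank⇒∉QF odd fv q∈QF

    rank≤maxPred : ∀ {m r P} μ → TightWithRank A α m r → IsLevel A α (suc m) P →
                   (∀ R → IsLevel A α m R → ∀ q j → FVal A α m q j → j ≤ infμ A μ R q) →
                   r ≤ maxPred A μ P
    rank≤maxPred μ tight-m P-lev bounded with tight⇒level tight-m
    ... | R , R-lev = ≤-trans (tight-rank≤μ μ R tight-m (bounded R R-lev))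
                              (μ≤maxPred μ (isPred⁺ {R = R} (δset-level R-lev P-lev)))

lemma9 : ∀ {n s : ℕ} (A : BA n s) (μ : Subset n → ℕ) (S : Subset n)
    → TRUBμ A μ → TRUBμ A (μ' A μ S)
lemma9 A μ S trub α α∉L with trub α α∉L
... | ℓ , (r , tight) , bounded = suc ℓ , (r , λ k ℓ<k → tight k (<⇒≤ ℓ<k)) , bounded′
  where
  bounded′ : ∀ k → suc ℓ ≤ k → ∀ P → IsLevel A α k P → ∀ q j → FVal A α k q j →
             j ≤ infμ A (μ' A μ S) P q
  bounded′ (suc m) (s≤s ℓ≤m) P P-lev q j fv = ≤-infμ-μ′ A μ S P q j≤infμ j≤inf-maxPred
    where
    ℓ≤m+1 : ℓ ≤ suc m
    ℓ≤m+1 = ≤-trans ℓ≤m (n≤1+n m)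
    j≤infμ : j ≤ infμ A μ P q
    j≤infμ = bounded (suc m) ℓ≤m+1 P P-lev q j fv
    r≤maxPred : r ≤ maxPred A μ P
    r≤maxPred = rank≤maxPred A α μ (tight m ℓ≤m) P-lev (bounded m ℓ≤m)
    j≤inf-maxPred : j ≤ infμ A (maxPred A μ) P q
    j≤inf-maxPred = tight-≤-infμ A α (maxPred A μ) P (tight (suc m) ℓ≤m+1) r≤maxPred fv
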